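{- Let $m$ be an odd positive integer. Take the vertex set of $K_{2m+1}$ to be $\{v_\infty\}\cup\{v_{i,j}: i\in[m],\ j\in[2]\}$, with first index taken modulo $m$. For an integer $x$ let $P_{x,m}=\bigl\{\{x+l,x-l\}: l\in[\tfrac{m+1}{2}]\bigr\}$, entries modulo $m$. For $i\in[m]$ let $R_i$ be the subgraph with edge set \[ \bigl\{\{v_\infty,v_{i,0}\},\{v_\infty,v_{i,1}\},\{v_{i,0},v_{i,1}\}\bigr\}\cup\bigl\{\{v_{a_1,b_1},v_{a_2,b_2}\}: \{a_1,a_2\}\in P_{i,m},\ a_1\ne i,\ b_1,b_2\in[2]\bigr\}. \] Then $\{R_0,\dots,R_{m-1}\}$ is a $2$-regular decomposition of $K_{2m+1}$: each $R_i$ is a $2$-regular spanning subgraph and every edge of $K_{2m+1}$ lies in exactly one $R_i$.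
   Context: For an integer $N$, $[N]=\{0,1,\dots,N-1\}$. -}

module Defs where

open import Data.Nat using (ℕ; _<_; _+_)
open import Data.Nat.DivMod using (_/_)
open import Data.Fin using (Fin; toℕ)
open import Data.Integer as ℤ using (ℤ; +_; _-_)
open import Data.Integer.Divisibility using (_∣_)
open import Data.Product using (Σ; _×_; ∃)
open import Data.Sum using (_⊎_)
open import Relation.Binary.PropositionalEquality using (_≡_; _≢_)

data Vertex (m : ℕ) : Set where
  v∞ : Vertex m
  v  : Fin m → Fin 2 → Vertex m

_≡_[mod_] : ℤ → ℤ → ℕ → Set
x ≡ y [mod m ] = (+ m) ∣ (x - y)

_≅_[mod_] : {m : ℕ} → Fin m → ℤ → ℕ → Set
a ≅ x [mod m ] = (+ toℕ a) ≡ x [mod m ]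

InP : (m : ℕ) → ℤ → Fin m → Fin m → Set
InP m x a₁ a₂ = Σ ℕ λ l → l < (m + 1) / 2 ×
  ((a₁ ≅ x ℤ.+ (+ l) [mod m ] × a₂ ≅ x - (+ l) [mod m ])
   ⊎ (a₁ ≅ x - (+ l) [mod m ] × a₂ ≅ x ℤ.+ (+ l) [mod m ]))

-- Edge relation of R_i (u and w joined by an edge of R_i).
-- The unordered edge {u,w} of the definition is encoded symmetrically.
R : (m : ℕ) → Fin m → Vertex m → Vertex m → Set
R m i v∞ v∞ = Data.Empty.⊥ where import Data.Empty
R m i v∞ (v a b) = a ≡ i
R m i (v a b) v∞ = a ≡ i
R m i (v a₁ b₁) (v a₂ b₂) =
  (a₁ ≡ i × a₂ ≡ i × b₁ ≢ b₂)
  ⊎ (InP m (+ toℕ i) a₁ a₂ × a₁ ≢ i)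
  ⊎ (InP m (+ toℕ i) a₂ a₁ × a₂ ≢ i)

Degree2 : {V : Set} → (V → V → Set) → V → Set
Degree2 {V} E u = Σ V λ w₁ → Σ V λ w₂ → w₁ ≢ w₂ × E u w₁ × E u w₂ ×
  ((w : V) → E u w → w ≡ w₁ ⊎ w ≡ w₂)

-- {a₁, a₂} ∈ P_{i,m} says exactly that a₁ + a₂ ≡ 2i (mod m). As m is odd, 2 is
-- invertible modulo m, so two distinct columns a ≠ c have exactly one midpoint i,
-- and a column a ≠ i has exactly one partner c with a + c ≡ 2i, while i is its own
-- partner. Hence in R_i the vertex v∞ is joined to v_{i,0} and v_{i,1}, each v_{i,b}
-- to v∞ and v_{i,1-b}, and each v_{a,b} with a ≠ i to the two vertices of its
-- partner column; and an edge {v_{a,b}, v_{c,d}} lies in R_a if a = c and in R_i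
-- for the midpoint i of a and c otherwise.
module Submission where

open import Data.Fin using (Fin; zero; suc; opposite; toℕ; fromℕ<; _≟_)
open import Data.Fin.Properties using (toℕ-injective; toℕ<n; toℕ-fromℕ<)
open import Data.Nat as ℕ using (ℕ; NonZero; _≤_; _<_; _∸_; _≤?_; _/_; s≤s)
import Data.Nat.Properties as ℕₚ
open import Data.Nat.Divisibility using (>⇒∤) renaming (_∣_ to _∣ℕ_)
open import Data.Product using (Σ; _×_; ∃; _,_; proj₂)
open import Data.Sum as Sum using (_⊎_; inj₁; inj₂)
open import Function using (_∘_)
open import Level using (0ℓ)
open import Relation.Binary.Bundles using (Setoid)
open import Relation.Binary.PropositionalEquality using (_≡_; _≢_; refl; sym; trans; cong; subst)
import Relation.Binary.Reasoning.Setoid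
open import Relation.Nullary using (yes; no; contradiction)

open import Defs

m∣n∧n<m⇒n≡0 : ∀ {m n} → m ∣ℕ n → n < m → n ≡ 0
m∣n∧n<m⇒n≡0 {n = ℕ.zero}  _   _   = refl
m∣n∧n<m⇒n≡0 {n = ℕ.suc _} m∣n n<m = contradiction m∣n (>⇒∤ n<m)

opposite-≢ : (b : Fin 2) → b ≢ opposite b
opposite-≢ zero       ()
opposite-≢ (suc zero) ()

≢⇒≡opposite : {b d : Fin 2} → b ≢ d → d ≡ opposite b
≢⇒≡opposite {zero}     {zero}     b≢d = contradiction refl b≢d
≢⇒≡opposite {zero}     {suc zero} _   = refl
≢⇒≡opposite {suc zero} {zero}     _   = refl
≢⇒≡opposite {suc zero} {suc zero} b≢d = contradiction refl b≢d

zero⊎one : (d : Fin 2) → d ≡ zero ⊎ d ≡ suc zero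
zero⊎one zero       = inj₁ refl
zero⊎one (suc zero) = inj₂ refl

R-sym : ∀ {m} i (u w : Vertex m) → R m i u w → R m i w u
R-sym i v∞      v∞      ()
R-sym i v∞      (v _ _) r = r
R-sym i (v _ _) v∞      r = r
R-sym i (v _ _) (v _ _) (inj₁ (a≡i , c≡i , b≢d)) = inj₁ (c≡i , a≡i , b≢d ∘ sym)
R-sym i (v _ _) (v _ _) (inj₂ (inj₁ chord))      = inj₂ (inj₂ chord)
R-sym i (v _ _) (v _ _) (inj₂ (inj₂ chord))      = inj₂ (inj₁ chord)

module Congruence (m : ℕ) where

  open import Data.Integer using (ℤ; +_; -_; _+_; _-_; _*_; 0ℤ; ∣_∣)
  open import Data.Integer.DivMod using (_%ℕ_; _/ℕ_; n%ℕd<d; a≡a%ℕn+[a/ℕn]*n)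
  open import Data.Integer.Divisibility.Signed
    using (_∣_; divides; ∣-refl; ∣⇒∣ᵤ; ∣ᵤ⇒∣; ∣m∣n⇒∣m+n; ∣m⇒∣-m; ∣n⇒∣m*n)
  open import Data.Integer.Properties
    using (+-comm; +-identityʳ; neg-involutive; pos-+; +-injective;
           m-n≡m⊖n; ∣m⊝n∣≤m⊔n; ∣i∣≡0⇒i≡0; i-j≡0⇒i≡j)
  open import Data.Integer.Tactic.RingSolver using (solve)
  open import Data.List using (_∷_; [])

  -- Signed divisibility, equivalent to the x ≡ y [mod m ] of Defs; the record
  -- wrapper keeps x and y inferable from a proof.
  infix 4 _≈_
  record _≈_ (x y : ℤ) : Set where
    constructor congruent
    field divides-difference : + m ∣ x - y

  private
    variable
      x y z u w d : ℤ

  ≈-by : + m ∣ d → d ≡ x - y → x ≈ y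
  ≈-by m∣d refl = congruent m∣d

  ≈-refl : x ≈ x
  ≈-refl {x} = ≈-by (divides 0ℤ refl) (solve (x ∷ []))

  ≈-reflexive : x ≡ y → x ≈ y
  ≈-reflexive refl = ≈-refl

  ≈-sym : x ≈ y → y ≈ x
  ≈-sym {x} {y} (congruent p) = ≈-by (∣m⇒∣-m p) (solve (x ∷ y ∷ []))

  ≈-trans : x ≈ y → y ≈ z → x ≈ z
  ≈-trans {x} {y} {z} (congruent p) (congruent q) =
    ≈-by (∣m∣n⇒∣m+n p q) (solve (x ∷ y ∷ z ∷ []))

  ≈-setoid : Setoid 0ℓ 0ℓ
  ≈-setoid = record
    { Carrier       = ℤ
    ; _≈_           = _≈_
    ; isEquivalence = record { refl = ≈-refl ; sym = ≈-sym ; trans = ≈-trans }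
    }

  module ≈-Reasoning = Relation.Binary.Reasoning.Setoid ≈-setoid
  open ≈-Reasoning

  +-cong : x ≈ y → u ≈ w → x + u ≈ y + w
  +-cong {x} {y} {u} {w} (congruent p) (congruent q) =
    ≈-by (∣m∣n⇒∣m+n p q) (solve (x ∷ y ∷ u ∷ w ∷ []))

  -‿cong : x ≈ y → - x ≈ - y
  -‿cong {x} {y} (congruent p) = ≈-by (∣m⇒∣-m p) (solve (x ∷ y ∷ []))

  *-congˡ : ∀ z → x ≈ y → z * x ≈ z * y
  *-congˡ {x} {y} z (congruent p) = ≈-by (∣n⇒∣m*n z p) (solve (z ∷ x ∷ y ∷ []))

  +-cancelˡ : ∀ x → x + y ≈ x + z → y ≈ z
  +-cancelˡ {y} {z} x (congruent p) = ≈-by p (solve (x ∷ y ∷ z ∷ []))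

  multiple≈0 : ∀ q → q * + m ≈ 0ℤ
  multiple≈0 q = ≈-by (divides q refl) (sym (+-identityʳ (q * + m)))

  ≈-complement : ∀ {n} → n ≤ m → + n ≈ - + (m ∸ n)
  ≈-complement {n} n≤m = ≈-by ∣-refl (sym n+[m∸n]≡m)
    where
    n+[m∸n]≡m : + n - - + (m ∸ n) ≡ + m
    n+[m∸n]≡m = trans (cong (_+_ (+ n)) (neg-involutive (+ (m ∸ n))))
      (trans (sym (pos-+ n (m ∸ n))) (cong +_ (ℕₚ.m+[n∸m]≡n n≤m)))

  ≈⇒≡[mod] : x ≈ y → x ≡ y [mod m ]
  ≈⇒≡[mod] (congruent p) = ∣⇒∣ᵤ p

  ≡[mod]⇒≈ : x ≡ y [mod m ] → x ≈ y
  ≡[mod]⇒≈ p = congruent (∣ᵤ⇒∣ p)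

  shift : ∀ x → y - x ≈ d → y ≈ x + d
  shift {y} {d} x y-x≈d = begin
    y              ≡⟨ solve (x ∷ y ∷ []) ⟩
    x + (y - x)    ≈⟨ +-cong (≈-refl {x}) y-x≈d ⟩
    x + d          ∎

  sum-of-opposite-offsets : ∀ x d → y ≈ x + d → z ≈ x - d → y + z ≈ x + x
  sum-of-opposite-offsets {y} {z} x d p q = begin
    y + z               ≈⟨ +-cong p q ⟩
    (x + d) + (x - d)   ≡⟨ solve (x ∷ d ∷ []) ⟩
    x + x               ∎

  opposite-offset : ∀ x d → y + z ≈ x + x → y ≈ x + d → z ≈ x - d
  opposite-offset {y} {z} x d p q = begin
    z                   ≡⟨ solve (y ∷ z ∷ []) ⟩
    (y + z) - y         ≈⟨ +-cong p (-‿cong q) ⟩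
    (x + x) - (x + d)   ≡⟨ solve (x ∷ d ∷ []) ⟩
    x - d               ∎

  toℤ : Fin m → ℤ
  toℤ a = + toℕ a

  toℤ-injective-≈ : {a b : Fin m} → toℤ a ≈ toℤ b → a ≡ b
  toℤ-injective-≈ {a} {b} (congruent p) =
    toℕ-injective (+-injective (i-j≡0⇒i≡j _ _ (∣i∣≡0⇒i≡0 (m∣n∧n<m⇒n≡0 (∣⇒∣ᵤ p) ∣a-b∣<m))))
    where
    ∣a-b∣<m : ∣ toℤ a - toℤ b ∣ < m
    ∣a-b∣<m = subst (_< m) (cong ∣_∣ (sym (m-n≡m⊖n (toℕ a) (toℕ b))))
      (ℕₚ.≤-<-trans (∣m⊝n∣≤m⊔n (toℕ a) (toℕ b)) (ℕₚ.⊔-lub (toℕ<n a) (toℕ<n b)))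

  residue : .{{NonZero m}} → ∀ z → Σ (Fin m) λ a → z ≈ toℤ a
  residue z = fromℕ< r<m , (begin
    z                              ≡⟨ a≡a%ℕn+[a/ℕn]*n z m ⟩
    + (z %ℕ m) + (z /ℕ m) * + m    ≈⟨ +-cong (≈-refl {+ (z %ℕ m)}) (multiple≈0 (z /ℕ m)) ⟩
    + (z %ℕ m) + 0ℤ                ≡⟨ +-identityʳ (+ (z %ℕ m)) ⟩
    + (z %ℕ m)                     ≡⟨ cong +_ (toℕ-fromℕ< r<m) ⟨
    toℤ (fromℕ< r<m)               ∎)
    where
    r<m : z %ℕ m < m
    r<m = n%ℕd<d z m

  record Midpoint (i a b : Fin m) : Set where
    constructor mkMidpoint
    field sum≈double : toℤ a + toℤ b ≈ toℤ i + toℤ i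

  InP⇒Midpoint : ∀ {i a b} → InP m (toℤ i) a b → Midpoint i a b
  InP⇒Midpoint {i} {a} {b} (l , _ , inj₁ (a≅i+l , b≅i-l)) = mkMidpoint
    (sum-of-opposite-offsets (toℤ i) (+ l) (≡[mod]⇒≈ {toℤ a} a≅i+l) (≡[mod]⇒≈ {toℤ b} b≅i-l))
  InP⇒Midpoint {i} {a} {b} (l , _ , inj₂ (a≅i-l , b≅i+l)) = mkMidpoint (≈-trans
    (≈-reflexive (+-comm (toℤ a) (toℤ b)))
    (sum-of-opposite-offsets (toℤ i) (+ l) (≡[mod]⇒≈ {toℤ b} b≅i+l) (≡[mod]⇒≈ {toℤ a} a≅i-l)))

  Midpoint-sym : ∀ {i a b} → Midpoint i a b → Midpoint i b a
  Midpoint-sym {a = a} {b} (mkMidpoint p) = mkMidpoint (≈-trans (≈-reflexive (+-comm (toℤ b) (toℤ a))) p)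

  Midpoint-refl : ∀ i → Midpoint i i i
  Midpoint-refl i = mkMidpoint ≈-refl

  Midpoint-cancelˡ : ∀ {i a b c} → Midpoint i a b → Midpoint i a c → b ≡ c
  Midpoint-cancelˡ {a = a} (mkMidpoint p) (mkMidpoint q) =
    toℤ-injective-≈ (+-cancelˡ (toℤ a) (≈-trans p (≈-sym q)))

  Midpoint-center : ∀ {i b} → Midpoint i i b → b ≡ i
  Midpoint-center {i} p = Midpoint-cancelˡ p (Midpoint-refl i)

  partner : .{{NonZero m}} → ∀ i a → Σ (Fin m) (Midpoint i a)
  partner i a with residue ((toℤ i + toℤ i) - toℤ a)
  ... | c , 2i-a≈c = c , mkMidpoint (begin
    toℤ a + toℤ c                      ≈⟨ +-cong (≈-refl {toℤ a}) (≈-sym 2i-a≈c) ⟩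
    toℤ a + ((toℤ i + toℤ i) - toℤ a)  ≡⟨ cancel (toℤ a) (toℤ i + toℤ i) ⟩
    toℤ i + toℤ i                      ∎)
    where
    cancel : ∀ a s → a + (s - a) ≡ s
    cancel a s = solve (a ∷ s ∷ [])

module OddModulus (k : ℕ) where

  m : ℕ
  m = 1 ℕ.+ 2 ℕ.* k

  open Congruence m
  open ≈-Reasoning

  open import Data.Integer using (ℤ; +_; -_; _+_; _-_; _*_; 0ℤ; 1ℤ)
  open import Data.Integer.Properties using (pos-+; pos-*; +-identityˡ; *-distribˡ-+; neg-involutive)
  open import Data.Integer.Tactic.RingSolver using (solve-∀)
  import Data.Nat.Tactic.RingSolver as ℕ-Solver
  open import Data.Nat.DivMod using (m*n/n≡m)

  ≤k⇒<[m+1]/2 : ∀ {l} → l ≤ k → l < (m ℕ.+ 1) / 2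
  ≤k⇒<[m+1]/2 {l} l≤k = subst (l <_) (sym [m+1]/2≡1+k) (s≤s l≤k)
    where
    m+1≡[1+k]*2 : ∀ k → 1 ℕ.+ 2 ℕ.* k ℕ.+ 1 ≡ ℕ.suc k ℕ.* 2
    m+1≡[1+k]*2 = ℕ-Solver.solve-∀
    [m+1]/2≡1+k : (m ℕ.+ 1) / 2 ≡ ℕ.suc k
    [m+1]/2≡1+k = trans (cong (_/ 2) (m+1≡[1+k]*2 k)) (m*n/n≡m (ℕ.suc k) 2)

  m∸[1+k]≡k : m ∸ ℕ.suc k ≡ k
  m∸[1+k]≡k = trans (ℕₚ.m+n∸m≡n k (k ℕ.+ 0)) (ℕₚ.+-identityʳ k)

  -- (k+1)·2 = m + 1, so k + 1 inverts 2 modulo m.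
  twice-inverse : ∀ z → + ℕ.suc k * (z + z) ≈ z
  twice-inverse z = begin
    + ℕ.suc k * (z + z)          ≡⟨ cong (_* (z + z)) (pos-+ 1 k) ⟩
    (1ℤ + + k) * (z + z)         ≡⟨ expand (+ k) z ⟩
    z * (1ℤ + + 2 * + k) + z     ≡⟨ cong (λ n → z * n + z) +m≡1+2k ⟨
    z * + m + z                  ≈⟨ +-cong (multiple≈0 z) (≈-refl {z}) ⟩
    0ℤ + z                       ≡⟨ +-identityˡ z ⟩
    z                            ∎
    where
    expand : ∀ K z → (1ℤ + K) * (z + z) ≡ z * (1ℤ + + 2 * K) + z
    expand = solve-∀
    +m≡1+2k : + m ≡ 1ℤ + + 2 * + k
    +m≡1+2k = trans (pos-+ 1 (2 ℕ.* k)) (cong (_+_ 1ℤ) (pos-* 2 k))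

  halve : ∀ {x y} → x + x ≈ y + y → x ≈ y
  halve {x} {y} 2x≈2y = begin
    x                        ≈⟨ twice-inverse x ⟨
    + ℕ.suc k * (x + x)      ≈⟨ *-congˡ (+ ℕ.suc k) 2x≈2y ⟩
    + ℕ.suc k * (y + y)      ≈⟨ twice-inverse y ⟩
    y                        ∎

  half : ∀ z → Σ ℤ λ w → w + w ≈ z
  half z = + ℕ.suc k * z , (begin
    + ℕ.suc k * z + + ℕ.suc k * z    ≡⟨ *-distribˡ-+ (+ ℕ.suc k) z z ⟨
    + ℕ.suc k * (z + z)              ≈⟨ twice-inverse z ⟩
    z                                ∎)

  symmetric-residue : ∀ z → Σ ℕ λ l → l ≤ k × (z ≈ + l ⊎ z ≈ - + l)
  symmetric-residue z with residue z
  ... | a , z≈a with toℕ a ≤? k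
  ...   | yes a≤k = toℕ a , a≤k , inj₁ z≈a
  ...   | no  a≰k = m ∸ toℕ a , m∸a≤k , inj₂ (≈-trans z≈a (≈-complement (ℕₚ.<⇒≤ (toℕ<n a))))
    where
    m∸a≤k : m ∸ toℕ a ≤ k
    m∸a≤k = subst (m ∸ toℕ a ≤_) m∸[1+k]≡k (ℕₚ.∸-monoʳ-≤ m (ℕₚ.≰⇒> a≰k))

  Midpoint⇒InP : ∀ {i a b} → Midpoint i a b → InP m (toℤ i) a b
  Midpoint⇒InP {i} {a} {b} (mkMidpoint a+b≈2i) with symmetric-residue (toℤ a - toℤ i)
  ... | l , l≤k , inj₁ a-i≈l =
    l , ≤k⇒<[m+1]/2 l≤k , inj₁ (≈⇒≡[mod] a≈i+l , ≈⇒≡[mod] b≈i-l)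
    where
    a≈i+l : toℤ a ≈ toℤ i + + l
    a≈i+l = shift (toℤ i) a-i≈l
    b≈i-l : toℤ b ≈ toℤ i - + l
    b≈i-l = opposite-offset (toℤ i) (+ l) a+b≈2i a≈i+l
  ... | l , l≤k , inj₂ a-i≈-l =
    l , ≤k⇒<[m+1]/2 l≤k , inj₂ (≈⇒≡[mod] a≈i-l , ≈⇒≡[mod] b≈i+l)
    where
    a≈i-l : toℤ a ≈ toℤ i - + l
    a≈i-l = shift (toℤ i) a-i≈-l
    b≈i+l : toℤ b ≈ toℤ i + + l
    b≈i+l = ≈-trans (opposite-offset (toℤ i) (- + l) a+b≈2i a≈i-l)
      (≈-reflexive (cong (_+_ (toℤ i)) (neg-involutive (+ l))))

  Midpoint-self : ∀ {i a} → Midpoint i a a → a ≡ i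
  Midpoint-self (mkMidpoint p) = toℤ-injective-≈ (halve p)

  Midpoint-unique : ∀ {i j a b} → Midpoint i a b → Midpoint j a b → i ≡ j
  Midpoint-unique (mkMidpoint p) (mkMidpoint q) = toℤ-injective-≈ (halve (≈-trans (≈-sym p) q))

  midpoint : ∀ a b → Σ (Fin m) λ i → Midpoint i a b
  midpoint a b with half (toℤ a + toℤ b)
  ... | w , 2w≈a+b with residue w
  ...   | i , w≈i = i , mkMidpoint (≈-sym (≈-trans (+-cong (≈-sym w≈i) (≈-sym w≈i)) 2w≈a+b))

module Decomposition (k : ℕ) where

  open OddModulus k
  open Congruence m using (Midpoint; InP⇒Midpoint; Midpoint-sym; Midpoint-cancelˡ; Midpoint-center; partner)

  R-pair⇒ : ∀ {i a b c d} → R m i (v a b) (v c d) → (a ≡ i × c ≡ i × b ≢ d) ⊎ (Midpoint i a c × a ≢ i)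
  R-pair⇒ (inj₁ spoke) = inj₁ spoke
  R-pair⇒ {i} {a} {c = c} (inj₂ (inj₁ (a-c∈P , a≢i))) = inj₂ (InP⇒Midpoint {i} {a} {c} a-c∈P , a≢i)
  R-pair⇒ {i} {a} {c = c} (inj₂ (inj₂ (c-a∈P , c≢i))) = inj₂ (mid , λ { refl → c≢i (Midpoint-center mid) })
    where
    mid : Midpoint i a c
    mid = Midpoint-sym (InP⇒Midpoint {i} {c} {a} c-a∈P)

  R-pair⇐ : ∀ {i a b c d} → Midpoint i a c → a ≢ i → R m i (v a b) (v c d)
  R-pair⇐ mid a≢i = inj₂ (inj₁ (Midpoint⇒InP mid , a≢i))

  R⇒≢ : ∀ {i u w} → R m i u w → u ≢ w
  R⇒≢ {u = v∞}    () refl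
  R⇒≢ {u = v a b} r  refl with R-pair⇒ r
  ... | inj₁ (_ , _ , b≢b) = b≢b refl
  ... | inj₂ (mid , a≢i)   = a≢i (Midpoint-self mid)

  hub-degree2 : ∀ i → Degree2 (R m i) v∞
  hub-degree2 i = v i zero , v i (suc zero) , (λ ()) , refl , refl , neighbours
    where
    neighbours : ∀ w → R m i v∞ w → w ≡ v i zero ⊎ w ≡ v i (suc zero)
    neighbours (v a d) refl = Sum.map (cong (v a)) (cong (v a)) (zero⊎one d)

  row-degree2 : ∀ i b → Degree2 (R m i) (v i b)
  row-degree2 i b = v∞ , v i (opposite b) , (λ ()) , refl , inj₁ (refl , refl , opposite-≢ b) , neighbours
    where
    neighbours : ∀ w → R m i (v i b) w → w ≡ v∞ ⊎ w ≡ v i (opposite b)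
    neighbours v∞ _ = inj₁ refl
    neighbours (v c d) r with R-pair⇒ r
    ... | inj₁ (_ , refl , b≢d) = inj₂ (cong (v i) (≢⇒≡opposite b≢d))
    ... | inj₂ (_ , i≢i)        = contradiction refl i≢i

  off-row-degree2 : ∀ {i a c} b → a ≢ i → Midpoint i a c → Degree2 (R m i) (v a b)
  off-row-degree2 {i} {a} {c} b a≢i mid =
    v c zero , v c (suc zero) , (λ ()) , R-pair⇐ mid a≢i , R-pair⇐ mid a≢i , neighbours
    where
    neighbours : ∀ w → R m i (v a b) w → w ≡ v c zero ⊎ w ≡ v c (suc zero)
    neighbours v∞ a≡i = contradiction a≡i a≢i
    neighbours (v c′ d) r with R-pair⇒ r
    ... | inj₁ (a≡i , _) = contradiction a≡i a≢i
    ... | inj₂ (mid′ , _) with Midpoint-cancelˡ mid mid′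
    ... | refl = Sum.map (cong (v c)) (cong (v c)) (zero⊎one d)

  degree2 : ∀ i u → Degree2 (R m i) u
  degree2 i v∞      = hub-degree2 i
  degree2 i (v a b) with a ≟ i
  ... | yes refl = row-degree2 a b
  ... | no  a≢i  = off-row-degree2 b a≢i (proj₂ (partner i a))

  CoveredOnce : Vertex m → Vertex m → Set
  CoveredOnce u w = Σ (Fin m) λ i → R m i u w × (∀ j → R m j u w → j ≡ i)

  column-covered-once : ∀ a {b d} → b ≢ d → CoveredOnce (v a b) (v a d)
  column-covered-once a {b} {d} b≢d = a , inj₁ (refl , refl , b≢d) , only-a
    where
    only-a : ∀ j → R m j (v a b) (v a d) → j ≡ a
    only-a j r with R-pair⇒ r
    ... | inj₁ (a≡j , _)   = sym a≡j
    ... | inj₂ (mid , a≢j) = contradiction (Midpoint-self mid) a≢j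

  chord-covered-once : ∀ {i a c} b d → a ≢ c → Midpoint i a c → CoveredOnce (v a b) (v c d)
  chord-covered-once {i} {a} {c} b d a≢c mid = i , R-pair⇐ mid a≢i , only-i
    where
    a≢i : a ≢ i
    a≢i refl = a≢c (sym (Midpoint-center mid))
    only-i : ∀ j → R m j (v a b) (v c d) → j ≡ i
    only-i j r with R-pair⇒ r
    ... | inj₁ (a≡j , c≡j , _) = contradiction (trans a≡j (sym c≡j)) a≢c
    ... | inj₂ (mid′ , _)      = Midpoint-unique mid′ mid

  covered-once : ∀ u w → u ≢ w → CoveredOnce u w
  covered-once v∞      v∞      u≢w = contradiction refl u≢w
  covered-once v∞      (v a _) _   = a , refl , λ _ → sym
  covered-once (v a _) v∞      _   = a , refl , λ _ → sym
  covered-once (v a b) (v c d) u≢w with a ≟ c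
  ... | yes refl = column-covered-once a (λ b≡d → u≢w (cong (v a) b≡d))
  ... | no  a≢c  = chord-covered-once b d a≢c (proj₂ (midpoint a c))

open import Data.Nat using (_+_; _*_)

lemma21 : (m : ℕ) → (∃ λ k → m ≡ 1 + 2 * k) →
    -- each R_i is a 2-regular spanning subgraph of K_{2m+1}
    ((i : Fin m) →
      ((u w : Vertex m) → R m i u w → u ≢ w × R m i w u)
      × ((u : Vertex m) → Degree2 (R m i) u))
    -- every edge of K_{2m+1} lies in exactly one R_i
    × ((u w : Vertex m) → u ≢ w →
        Σ (Fin m) λ i → R m i u w × ((j : Fin m) → R m j u w → j ≡ i))
lemma21 .(1 + 2 * k) (k , refl) =
  (λ i → (λ u w r → R⇒≢ r , R-sym i u w r) , degree2 i) , covered-once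
  where
  open Decomposition k
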